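{- Let $m, n$ be positive integers and $k$ an integer with $k \geq (-1)^{n-1} f_{n-2}(m) + 1$. Put $$s = s(n,m,k) = (-1)^n f_n(m) f_{n-1}(m) + k f_{n+1}(m), \qquad t = t(n,m,k) = (-1)^{n-1} f_{n-1}(m)^2 - k f_n(m),$$ and $\alpha(n,m,k) = \frac{1}{2}\left(\sqrt{s^2 - 4t} - s\right)$. Then $1 < 2\alpha(n,1,k) < 2$, and $0 < 2\alpha(n,m,k) < 1$ whenever $m \geq 2$.
   Context: The Fibonacci polynomials $f_h(m)$, for a fixed integer $m$, are defined by $f_0(m) = 0$, $f_1(m) = 1$, $f_h(m) = m f_{h-1}(m) + f_{h-2}(m)$ for $h \geq 2$, and for negative indices by $f_{ -h}(m) = (-1)^{h-1} f_h(m)$ for $h \geq 1$. -}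

module Defs where

open import Data.Nat using (ℕ; zero; suc)
open import Data.Integer using (ℤ; +_; -[1+_]; _+_; _-_; _*_; -_; _<_; _≤_)
open import Data.Product using (_×_)
open import Data.Sum using (_⊎_)

negOnePow : ℕ → ℤ
negOnePow zero    = + 1
negOnePow (suc j) = - negOnePow j

fib : ℤ → ℕ → ℤ
fib m zero            = + 0
fib m (suc zero)      = + 1
fib m (suc (suc h))   = m * fib m (suc h) + fib m h

-- integer index: f_{-h}(m) = (-1)^{h-1} f_h(m) for h ≥ 1
-- (-[1+ h ] is the integer -(h+1), so the sign is (-1)^h)
fibℤ : ℤ → ℤ → ℤ
fibℤ m (+ h)      = fib m h
fibℤ m -[1+ h ]   = negOnePow h * fib m (suc h)

sPar : ℕ → ℤ → ℤ → ℤ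
sPar n m k = negOnePow n * fibℤ m (+ n) * fibℤ m (+ n - + 1) + k * fibℤ m (+ n + + 1)

-- t(n,m,k) = (-1)^{n-1} f_{n-1}(m)^2 - k f_n(m)
-- (negOnePow (suc n) = (-1)^{n+1} = (-1)^{n-1})
tPar : ℕ → ℤ → ℤ → ℤ
tPar n m k = negOnePow (suc n) * (fibℤ m (+ n - + 1) * fibℤ m (+ n - + 1)) - k * fibℤ m (+ n)

disc : ℕ → ℤ → ℤ → ℤ
disc n m k = sPar n m k * sPar n m k - + 4 * tPar n m k

-- Comparisons of an integer with the (nonnegative real) square root of an
-- integer D ≥ 0, unfolded literally:
--   a < √D  iff  a < 0 or a² < D ;   √D < b  iff  0 < b and D < b².
_<√_ : ℤ → ℤ → Set
a <√ D = (a < + 0) ⊎ (a * a < D)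

√_<_ : ℤ → ℤ → Set
√ D < b = (+ 0 < b) × (D < b * b)

-- 2α(n,m,k) = √(s² − 4t) − s.  Hence
--   a < 2α  iff  s + a < √(s²−4t),   2α < b  iff  √(s²−4t) < s + b.
_<2α[_,_,_] : ℤ → ℕ → ℤ → ℤ → Set
a <2α[ n , m , k ] = (sPar n m k + a) <√ disc n m k

2α[_,_,_]<_ : ℕ → ℤ → ℤ → ℤ → Set
2α[ n , m , k ]< b = √ disc n m k < (sPar n m k + b)

{-# OPTIONS --safe #-}
-- Write k = k₀ + c with k₀ = (-1)^(n-1) f_(n-2)(m) and c ≥ 0 (the bounds already hold at
-- k = k₀).  Cassini's identity f_n f_(n-2) - f_(n-1)² = (-1)^(n-1) collapses s and t to
-- s = m + c f_(n+1) ≥ 0 and t = -(1 + c f_n) < 0.  Then s² - 4t is a natural number, and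
-- comparing 2α = √(s² - 4t) - s with an integer a ≥ 0 amounts to comparing s² - 4t with
-- (s + a)²: a polynomial identity in m, c, f_n, f_(n-1) with a visibly positive remainder,
-- where for m = 1 one also needs f_(n-1) ≤ f_n.
module Submission where

open import Defs
open import Data.Nat using (ℕ)
open import Data.Integer using (ℤ; +_; _+_; _-_; _*_; _≤_)
open import Data.Product using (_×_)
open import Relation.Binary.PropositionalEquality using (_≡_)

open import Data.Nat as ℕ using (zero; suc; z≤n; s≤s)
import Data.Nat.Properties as ℕ
open import Data.Integer using (-_; ∣_∣; _<_; +≤+; +<+)
import Data.Integer.Properties as ℤ
open import Data.Product using (∃; _,_; map)
open import Data.Sum using (inj₂)
open import Relation.Binary.PropositionalEquality
  using (refl; sym; trans; cong; cong₂; subst; subst₂; module ≡-Reasoning)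
open import Data.Integer.Tactic.RingSolver using (solve-∀)
import Data.Nat.Tactic.RingSolver as ℕ-Solver

fibPrev : ℤ → ℕ → ℤ
fibPrev m p = fibℤ m (+ suc p - + 2)

threshold : ℤ → ℕ → ℤ
threshold m p = negOnePow p * fibPrev m p

fib-suc : ∀ m p → fib m (suc p) ≡ m * fib m p + fibPrev m p
fib-suc m zero    = sym (cong (_+ + 1) (ℤ.*-zeroʳ m))
fib-suc m (suc p) = refl

negOnePow-square : ∀ p → negOnePow p * negOnePow p ≡ + 1
negOnePow-square zero    = refl
negOnePow-square (suc p) = trans (neg-square (negOnePow p)) (negOnePow-square p)
  where
  neg-square : ∀ e → - e * - e ≡ e * e
  neg-square = solve-∀

cassini : ∀ m p → fib m (suc p) * fibPrev m p - fib m p * fib m p ≡ negOnePow p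
cassini m zero    = refl
cassini m (suc p) = begin
    (m * y + x) * x - y * y            ≡⟨ cong (λ w → (m * y + x) * x - y * w) (fib-suc m p) ⟩
    (m * y + x) * x - y * (m * x + z)  ≡⟨ shift m x y z ⟩
    - (y * z - x * x)                  ≡⟨ cong -_ (cassini m p) ⟩
    - negOnePow p                      ∎
  where
  open ≡-Reasoning
  x = fib m p
  y = fib m (suc p)
  z = fibPrev m p
  shift : ∀ m x y z → (m * y + x) * x - y * (m * x + z) ≡ - (y * z - x * x)
  shift = solve-∀

module _ (m : ℤ) (p : ℕ) (c : ℤ) where
  private
    e = negOnePow p
    x = fib m p
    y = fib m (suc p)
    z = fibPrev m p

  sPar-above-threshold : sPar (suc p) m (threshold m p + c) ≡ m + c * fib m (suc (suc p))
  sPar-above-threshold = begin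
      - e * y * x + (e * z + c) * fibℤ m (+ suc p + + 1)
    ≡⟨ cong₂ (λ u v → - e * u * x + (e * z + c) * v)
             (fib-suc m p) (cong (fib m) (ℕ.+-comm (suc p) 1)) ⟩
      - e * (m * x + z) * x + (e * z + c) * (m * y + x)
    ≡⟨ regroup m x y z e c ⟩
      m * (e * (y * z - x * x)) + c * (m * y + x)
    ≡⟨ cong (λ w → m * (e * w) + c * (m * y + x)) (cassini m p) ⟩
      m * (e * e) + c * (m * y + x)
    ≡⟨ cong (λ w → m * w + c * (m * y + x)) (negOnePow-square p) ⟩
      m * + 1 + c * (m * y + x)
    ≡⟨ cong (_+ c * (m * y + x)) (ℤ.*-identityʳ m) ⟩
      m + c * (m * y + x)
    ∎
    where
    open ≡-Reasoning
    regroup : ∀ m x y z e c → - e * (m * x + z) * x + (e * z + c) * (m * y + x)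
                              ≡ m * (e * (y * z - x * x)) + c * (m * y + x)
    regroup = solve-∀

  tPar-above-threshold : tPar (suc p) m (threshold m p + c) ≡ - (+ 1 + c * fib m (suc p))
  tPar-above-threshold = begin
      - - e * (x * x) - (e * z + c) * y  ≡⟨ regroup x y z e c ⟩
      - (e * (y * z - x * x) + c * y)    ≡⟨ cong (λ w → - (e * w + c * y)) (cassini m p) ⟩
      - (e * e + c * y)                  ≡⟨ cong (λ w → - (w + c * y)) (negOnePow-square p) ⟩
      - (+ 1 + c * y)                    ∎
    where
    open ≡-Reasoning
    regroup : ∀ x y z e c → - - e * (x * x) - (e * z + c) * y ≡ - (e * (y * z - x * x) + c * y)
    regroup = solve-∀

fibℕ : ℕ → ℕ → ℕ
fibℕ m zero          = 0
fibℕ m (suc zero)    = 1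
fibℕ m (suc (suc h)) = m ℕ.* fibℕ m (suc h) ℕ.+ fibℕ m h

fib-+ : ∀ m h → fib (+ m) h ≡ + fibℕ m h
fib-+ m zero          = refl
fib-+ m (suc zero)    = refl
fib-+ m (suc (suc h)) = begin
    + m * fib (+ m) (suc h) + fib (+ m) h  ≡⟨ cong₂ (λ u v → + m * u + v) (fib-+ m (suc h)) (fib-+ m h) ⟩
    + m * + fibℕ m (suc h) + + fibℕ m h    ≡⟨ cong (_+ + fibℕ m h) (sym (ℤ.pos-* m (fibℕ m (suc h)))) ⟩
    + fibℕ m (suc (suc h))                 ∎
  where open ≡-Reasoning

fibℕ-≤-suc : ∀ m h → fibℕ (suc m) h ℕ.≤ fibℕ (suc m) (suc h)
fibℕ-≤-suc m zero    = z≤n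
fibℕ-≤-suc m (suc h) = ℕ.≤-trans (ℕ.m≤m+n y (m ℕ.* y)) (ℕ.m≤m+n (suc m ℕ.* y) (fibℕ (suc m) h))
  where y = fibℕ (suc m) (suc h)

module _ (m p c : ℕ) where
  sPar-above-threshold-ℕ :
    sPar (suc p) (+ m) (threshold (+ m) p + + c) ≡ + (m ℕ.+ c ℕ.* fibℕ m (suc (suc p)))
  sPar-above-threshold-ℕ = begin
      sPar (suc p) (+ m) (threshold (+ m) p + + c)
    ≡⟨ sPar-above-threshold (+ m) p (+ c) ⟩
      + m + + c * fib (+ m) (suc (suc p))
    ≡⟨ cong (λ w → + m + + c * w) (fib-+ m (suc (suc p))) ⟩
      + m + + c * + fibℕ m (suc (suc p))
    ≡⟨ cong (λ w → + m + w) (sym (ℤ.pos-* c _)) ⟩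
      + (m ℕ.+ c ℕ.* fibℕ m (suc (suc p)))
    ∎
    where open ≡-Reasoning

  tPar-above-threshold-ℕ :
    tPar (suc p) (+ m) (threshold (+ m) p + + c) ≡ - + suc (c ℕ.* fibℕ m (suc p))
  tPar-above-threshold-ℕ = begin
      tPar (suc p) (+ m) (threshold (+ m) p + + c)
    ≡⟨ tPar-above-threshold (+ m) p (+ c) ⟩
      - (+ 1 + + c * fib (+ m) (suc p))
    ≡⟨ cong (λ w → - (+ 1 + + c * w)) (fib-+ m (suc p)) ⟩
      - (+ 1 + + c * + fibℕ m (suc p))
    ≡⟨ cong (λ w → - (+ 1 + w)) (sym (ℤ.pos-* c _)) ⟩
      - + suc (c ℕ.* fibℕ m (suc p))
    ∎
    where open ≡-Reasoning

module RootBounds {n m k} {S T : ℕ} (s≡S : sPar n m k ≡ + S) (t≡-T : tPar n m k ≡ - + T) where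
  D : ℕ
  D = S ℕ.* S ℕ.+ 4 ℕ.* T

  disc≡D : disc n m k ≡ + D
  disc≡D = begin
      sPar n m k * sPar n m k - + 4 * tPar n m k  ≡⟨ cong₂ (λ u v → u * u - + 4 * v) s≡S t≡-T ⟩
      + S * + S - + 4 * - + T                     ≡⟨ neg-neg (+ S) (+ T) ⟩
      + S * + S + + 4 * + T                       ≡⟨ cong₂ _+_ (sym (ℤ.pos-* S S)) (sym (ℤ.pos-* 4 T)) ⟩
      + D                                         ∎
    where
    open ≡-Reasoning
    neg-neg : ∀ s t → s * s - + 4 * - t ≡ s * s + + 4 * t
    neg-neg = solve-∀

  0≤disc : + 0 ≤ disc n m k
  0≤disc = subst (+ 0 ≤_) (sym disc≡D) (+≤+ z≤n)

  square-sPar+ : ∀ a → (sPar n m k + + a) * (sPar n m k + + a) ≡ + ((S ℕ.+ a) ℕ.* (S ℕ.+ a))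
  square-sPar+ a =
    trans (cong (λ w → (w + + a) * (w + + a)) s≡S) (sym (ℤ.pos-* (S ℕ.+ a) (S ℕ.+ a)))

  <2α : ∀ a → (S ℕ.+ a) ℕ.* (S ℕ.+ a) ℕ.< D → (+ a) <2α[ n , m , k ]
  <2α a square<D = inj₂ (subst₂ _<_ (sym (square-sPar+ a)) (sym disc≡D) (+<+ square<D))

  2α< : ∀ b → D ℕ.< (S ℕ.+ suc b) ℕ.* (S ℕ.+ suc b) → 2α[ n , m , k ]< (+ suc b)
  2α< b D<square =
      subst (λ w → + 0 < w + + suc b) (sym s≡S) (+<+ (ℕ.≤-trans (s≤s z≤n) (ℕ.m≤n+m (suc b) S)))
    , subst₂ _<_ (sym disc≡D) (sym (square-sPar+ (suc b))) (+<+ D<square)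

m+[1+o]≡n⇒m<n : ∀ {m n} o → m ℕ.+ suc o ≡ n → m ℕ.< n
m+[1+o]≡n⇒m<n {m} o refl = ℕ.m<m+n m (s≤s z≤n)

disc-between-squares-m≡1 : ∀ c x y → x ℕ.≤ y →
  let S = 1 ℕ.+ c ℕ.* (1 ℕ.* y ℕ.+ x)
      D = S ℕ.* S ℕ.+ 4 ℕ.* suc (c ℕ.* y)
  in  (S ℕ.+ 1) ℕ.* (S ℕ.+ 1) ℕ.< D × D ℕ.< (S ℕ.+ 2) ℕ.* (S ℕ.+ 2)
disc-between-squares-m≡1 c x y x≤y with ℕ.m≤n⇒∃[o]m+o≡n x≤y
... | d , refl = m+[1+o]≡n⇒m<n (2 ℕ.* c ℕ.* d) (lower c x d)
               , m+[1+o]≡n⇒m<n (3 ℕ.+ 4 ℕ.* c ℕ.* x) (upper c x d)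
  where
  lower : ∀ c x d → let S = 1 ℕ.+ c ℕ.* (1 ℕ.* (x ℕ.+ d) ℕ.+ x) in
    (S ℕ.+ 1) ℕ.* (S ℕ.+ 1) ℕ.+ suc (2 ℕ.* c ℕ.* d) ≡ S ℕ.* S ℕ.+ 4 ℕ.* suc (c ℕ.* (x ℕ.+ d))
  lower = ℕ-Solver.solve-∀
  upper : ∀ c x d → let S = 1 ℕ.+ c ℕ.* (1 ℕ.* (x ℕ.+ d) ℕ.+ x) in
    S ℕ.* S ℕ.+ 4 ℕ.* suc (c ℕ.* (x ℕ.+ d)) ℕ.+ suc (3 ℕ.+ 4 ℕ.* c ℕ.* x) ≡ (S ℕ.+ 2) ℕ.* (S ℕ.+ 2)
  upper = ℕ-Solver.solve-∀

disc-between-squares-m≥2 : ∀ m c x y →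
  let M = 2 ℕ.+ m
      S = M ℕ.+ c ℕ.* (M ℕ.* y ℕ.+ x)
      D = S ℕ.* S ℕ.+ 4 ℕ.* suc (c ℕ.* y)
  in  (S ℕ.+ 0) ℕ.* (S ℕ.+ 0) ℕ.< D × D ℕ.< (S ℕ.+ 1) ℕ.* (S ℕ.+ 1)
disc-between-squares-m≥2 m c x y =
    m+[1+o]≡n⇒m<n (3 ℕ.+ 4 ℕ.* c ℕ.* y) (lower m c x y)
  , m+[1+o]≡n⇒m<n (2 ℕ.* m ℕ.+ 2 ℕ.* c ℕ.* m ℕ.* y ℕ.+ 2 ℕ.* c ℕ.* x) (upper m c x y)
  where
  lower : ∀ m c x y → let M = 2 ℕ.+ m ; S = M ℕ.+ c ℕ.* (M ℕ.* y ℕ.+ x) in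
    (S ℕ.+ 0) ℕ.* (S ℕ.+ 0) ℕ.+ suc (3 ℕ.+ 4 ℕ.* c ℕ.* y) ≡ S ℕ.* S ℕ.+ 4 ℕ.* suc (c ℕ.* y)
  lower = ℕ-Solver.solve-∀
  upper : ∀ m c x y → let M = 2 ℕ.+ m ; S = M ℕ.+ c ℕ.* (M ℕ.* y ℕ.+ x) in
    S ℕ.* S ℕ.+ 4 ℕ.* suc (c ℕ.* y) ℕ.+ suc (2 ℕ.* m ℕ.+ 2 ℕ.* c ℕ.* m ℕ.* y ℕ.+ 2 ℕ.* c ℕ.* x)
      ≡ (S ℕ.+ 1) ℕ.* (S ℕ.+ 1)
  upper = ℕ-Solver.solve-∀

i≤j⇒∃[o]i+o≡j : ∀ {i j} → i ≤ j → ∃ λ o → i + + o ≡ j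
i≤j⇒∃[o]i+o≡j {i} {j} i≤j = ∣ j - i ∣ , (begin
    i + + ∣ j - i ∣  ≡⟨ cong (λ w → i + w) (ℤ.0≤i⇒+∣i∣≡i (ℤ.i≤j⇒0≤j-i i≤j)) ⟩
    i + (j - i)      ≡⟨ cancel i j ⟩
    j                ∎)
  where
  open ≡-Reasoning
  cancel : ∀ i j → i + (j - i) ≡ j
  cancel = solve-∀

lemma3p4 : (m n : ℕ) (k : ℤ) → + 1 ≤ + m → + 1 ≤ + n →
    negOnePow (n Data.Nat.∸ 1) * fibℤ (+ m) (+ n - + 2) + + 1 ≤ k →
    (+ 0 ≤ disc n (+ m) k)
    × (m ≡ 1 → ((+ 1) <2α[ n , + m , k ] × 2α[ n , + m , k ]< (+ 2)))
    × (+ 2 ≤ + m → ((+ 0) <2α[ n , + m , k ] × 2α[ n , + m , k ]< (+ 1)))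
lemma3p4 zero    _       _ (+≤+ ()) _        _
lemma3p4 (suc _) zero    _ _        (+≤+ ()) _
lemma3p4 (suc m) (suc p) k _        _        k₀<k
  with i≤j⇒∃[o]i+o≡j (ℤ.≤-trans (ℤ.i≤i+j (threshold (+ suc m) p) (+ 1)) k₀<k)
... | c , refl =
    0≤disc
  , (λ { refl → map (<2α 1) (2α< 1)
                  (disc-between-squares-m≡1 c (fibℕ 1 p) (fibℕ 1 (suc p)) (fibℕ-≤-suc 0 p)) })
  , (λ { (+≤+ (s≤s (s≤s {n = m-2} _))) → map (<2α 0) (2α< 0)
                  (disc-between-squares-m≥2 m-2 c (fibℕ (suc m) p) (fibℕ (suc m) (suc p))) })
  where
  open RootBounds {suc p} {+ suc m} {threshold (+ suc m) p + + c}
         (sPar-above-threshold-ℕ (suc m) p c) (tPar-above-threshold-ℕ (suc m) p c)
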